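{- For $n\geq 1$, the number of permutations $\pi\in\mathcal{S}_n$ such that both $\pi$ and $\theta(\pi)$ avoid $231$ equals $2^{n-1}$.
   Context: $\mathcal{S}_n$ is the symmetric group on $[n]$, permutations in one-line notation $\pi_1\cdots\pi_n$. A permutation avoids a pattern $\tau$ if it has no subsequence order-isomorphic to $\tau$. The standard cycle notation of $\pi$ writes each cycle (fixed points included) with its largest element first and orders cycles by increasing largest element. The fundamental bijection $\theta:\mathcal{S}_n\to\mathcal{S}_n$ maps $\pi$ to the permutation whose one-line notation is obtained by erasing the parentheses of the standard cycle notation of $\pi$. -}

module Defs where

open import Data.Nat using (ℕ; zero; suc; _<_; _≤_; _≟_; _<?_; _≤ᵇ_)
open import Data.Fin using (Fin) renaming (_<_ to _<ᶠ_; _<?_ to _<ᶠ?_)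
open import Data.Fin.Properties using (any?)
open import Data.List using (List; []; _∷_; length; lookup; map; concatMap; filter; upTo; applyUpTo)
open import Data.Bool.ListAction using (and)
open import Data.List.Relation.Unary.Unique.Propositional using (Unique)
import Data.List.Relation.Unary.Unique.DecPropositional as UD
open import Data.Product using (Σ; ∃; _×_; _,_)
open import Data.Product.Properties using () 
open import Relation.Nullary using (Dec; ¬_; ¬?; yes; no)
open import Relation.Nullary.Decidable using (_×-dec_)
open import Data.Bool using (Bool; true; false; if_then_else_)
open import Relation.Nullary.Decidable using (⌊_⌋)

-- Permutations of [n] = {1,…,n} are represented in one-line notation as
-- lists π₁ ⋯ πₙ of naturals.

words : ℕ → ℕ → List (List ℕ)
words n zero    = [] ∷ []
words n (suc k) = concatMap (λ a → map (a ∷_) (words n k)) (applyUpTo suc n)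

Sym : ℕ → List (List ℕ)
Sym n = filter (UD.unique? _≟_) (words n n)

Contains231 : List ℕ → Set
Contains231 π = ∃ λ (i : Fin (length π)) → ∃ λ (j : Fin (length π)) → ∃ λ (k : Fin (length π)) →
  (i <ᶠ j) × (j <ᶠ k) × (lookup π k < lookup π i) × (lookup π i < lookup π j)

Avoids231 : List ℕ → Set
Avoids231 π = ¬ Contains231 π

contains231? : (π : List ℕ) → Dec (Contains231 π)
contains231? π = any? λ i → any? λ j → any? λ k →
  (i <ᶠ? j) ×-dec ((j <ᶠ? k) ×-dec ((lookup π k <? lookup π i) ×-dec (lookup π i <? lookup π j)))

avoids231? : (π : List ℕ) → Dec (Avoids231 π)
avoids231? π = ¬? (contains231? π)

-- π as a function on [n]: app π m = πₘ (1-indexed; 0 outside the range)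
app : List ℕ → ℕ → ℕ
app []      _             = 0
app (x ∷ _) 1             = x
app (_ ∷ xs) (suc (suc m)) = app xs (suc m)
app (_ ∷ _) zero          = 0

orbitFrom : List ℕ → ℕ → ℕ → ℕ → List ℕ
orbitFrom π m zero     x = []
orbitFrom π m (suc f)  x with x ≟ m
... | yes _ = []
... | no  _ = x ∷ orbitFrom π m f (app π x)

cycleOf : List ℕ → ℕ → List ℕ
cycleOf π m = m ∷ orbitFrom π m (length π) (app π m)

isCycleMax : List ℕ → ℕ → Bool
isCycleMax π m = and (map (λ x → x ≤ᵇ m) (cycleOf π m))

-- the fundamental bijection θ: write the standard cycle notation (each cycle
-- led by its largest element, cycles ordered by increasing largest element)
-- and erase the parentheses
θ : List ℕ → List ℕ
θ π = concatMap (λ m → if isCycleMax π m then cycleOf π m else []) (applyUpTo suc (length π))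

both231? : (π : List ℕ) → Dec (Avoids231 π × Avoids231 (θ π))
both231? π = avoids231? π ×-dec avoids231? (θ π)

-- Call π ∈ 𝒮ₙ good if π and θ(π) avoid 231, and write N = n + 1. Every good permutation
-- of [N] arises from exactly one good π ∈ 𝒮ₙ in one of two ways: append N, which makes N a
-- fixed point and appends it to θ(π); or rename n to N and append n, which inserts N just
-- before n in the cycle of n, hence into θ(π) just before its last block (n …). Neither
-- step creates a 231. Conversely, the last entry b = σ(N) of a good σ is N or n. Otherwise
-- b < n, and N precedes n in σ because n N b is not a 231 of σ. If n is the maximum of its
-- cycle, θ(σ) ends with the blocks (n …)(N b …) and contains n N b; if not, n lies on the
-- cycle of N, which reads N … σ⁻¹(n) n … σ⁻¹(N) with σ⁻¹(N) < σ⁻¹(n) < n. So the number of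
-- good permutations doubles at each step, starting from 1 for n = 1.

module Submission where

open import Defs
open import Data.Bool using (true; false; T; if_then_else_)
open import Data.Bool.ListAction using (all)
open import Data.Empty using (⊥-elim)
open import Data.Fin using (Fin; zero; suc) renaming (_<_ to _<ᶠ_)
open import Data.List
  using (List; []; _∷_; [_]; _++_; length; lookup; map; filter; concatMap; applyUpTo;
         cartesianProductWith; initLast; _∷ʳ′_)
open import Data.List.Properties
  using (∷-injective; ∷ʳ-injectiveˡ; ∷ʳ-injectiveʳ; map-∘; map-id-local; map-injective; length-++;
         length-++-sucʳ; length-map; length-applyUpTo; applyUpTo-∷ʳ; concatMap-++; ++-assoc;
         ++-identityʳ)
open import Data.List.Membership.Propositional using (_∈_; _∉_; find)
open import Data.List.Membership.Propositional.Properties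
  using (∈-applyUpTo⁺; ∈-applyUpTo⁻; ∈-filter⁺; ∈-filter⁻; ∈-map⁺; ∈-map⁻; ∈-++⁺ˡ; ∈-++⁺ʳ;
         ∈-++⁻; ∈-cartesianProductWith⁺; ∈-cartesianProductWith⁻; ∈-lookup; ∈-∃++)
open import Data.List.Relation.Binary.Subset.Propositional using () renaming (_⊆_ to _⊆ₛ_)
open import Data.List.Relation.Binary.Sublist.Propositional
  using (_⊆_; []; _∷_; _∷ʳ_; ⊆-refl; ⊆-trans; from∈; minimum) renaming (lookup to ⊆-lookup)
open import Data.List.Relation.Binary.Sublist.Propositional.Properties
  using (++⁺; ++⁺ˡ; ++⁺ʳ; map⁺)
open import Data.List.Relation.Unary.All as All using (All; []; _∷_)
open import Data.List.Relation.Unary.All.Properties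
  using (all⁺; all⁻; ¬Any⇒All¬; ¬All⇒Any¬)
  renaming (++⁺ to All-++⁺; ++⁻ˡ to All-++⁻ˡ; ++⁻ʳ to All-++⁻ʳ; map⁺ to All-map⁺)
open import Data.List.Relation.Unary.AllPairs using ([]; _∷_)
open import Data.List.Relation.Unary.Any using (here; there)
open import Data.List.Relation.Unary.Unique.Propositional using (Unique)
import Data.List.Relation.Unary.Unique.Propositional.Properties as Unique
import Data.List.Relation.Unary.Unique.DecPropositional as UniqueDec
open import Data.Nat
  using (ℕ; zero; suc; pred; _+_; _*_; _∸_; _^_; _≤_; _<_; _≟_; _<?_; _≤ᵇ_; z≤n; s≤s; NonZero)
open import Data.Nat.Properties
open import Data.Nat.DivMod using (_%_; _/_; m≡m%n+[m/n]*n; m%n<n)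
open import Data.Nat.GeneralisedArithmetic using (iterate)
open import Data.List.Membership.DecPropositional _≟_ using (_∈?_)
open import Data.Product using (Σ; ∃; ∃₂; _×_; _,_; proj₁; proj₂)
open import Data.Sum as Sum using (_⊎_; inj₁; inj₂; [_,_]′)
open import Function using (_∘_; case_of_)
open import Relation.Binary.Definitions using (tri<; tri≈; tri>)
open import Relation.Binary.PropositionalEquality hiding ([_])
open import Relation.Nullary using (yes; no)

private
  variable
    A B C : Set
    xs ys : List A
    m x y : ℕ

∈-++-remove : ∀ (ys₁ : List A) {ys₂ x z} → z ∈ ys₁ ++ x ∷ ys₂ → z ≢ x → z ∈ ys₁ ++ ys₂
∈-++-remove []        (here z≡x) z≢x = ⊥-elim (z≢x z≡x)
∈-++-remove []        (there z∈) _   = z∈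
∈-++-remove (y ∷ ys₁) (here z≡y) _   = here z≡y
∈-++-remove (y ∷ ys₁) (there z∈) z≢x = there (∈-++-remove ys₁ z∈ z≢x)

unique⇒length-≤ : Unique xs → xs ⊆ₛ ys → length xs ≤ length ys
unique⇒length-≤ {xs = []}     _              _     = z≤n
unique⇒length-≤ {xs = x ∷ xs} (x∉xs ∷ uniq) xs⊆ys with ∈-∃++ (xs⊆ys (here refl))
... | ys₁ , ys₂ , refl = subst (suc (length xs) ≤_) (sym (length-++-sucʳ ys₁ x ys₂))
  (s≤s (unique⇒length-≤ uniq λ z∈xs →
    ∈-++-remove ys₁ (xs⊆ys (there z∈xs)) (≢-sym (All.lookup x∉xs z∈xs))))

unique⇒length-≡ : Unique xs → Unique ys → xs ⊆ₛ ys → ys ⊆ₛ xs → length xs ≡ length ys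
unique⇒length-≡ uxs uys xs⊆ys ys⊆xs =
  ≤-antisym (unique⇒length-≤ uxs xs⊆ys) (unique⇒length-≤ uys ys⊆xs)

length-++-[] : ∀ (xs : List A) {x} → length (xs ++ [ x ]) ≡ suc (length xs)
length-++-[] xs = trans (length-++-sucʳ xs _ []) (cong (suc ∘ length) (++-identityʳ xs))

InRange : ℕ → ℕ → Set
InRange n x = 0 < x × x ≤ n

record IsPerm (n : ℕ) (π : List ℕ) : Set where
  constructor perm
  field
    length≡ : length π ≡ n
    inRange : All (InRange n) π
    unique  : Unique π

∈-range⁻ : ∀ {n} → x ∈ applyUpTo suc n → InRange n x
∈-range⁻ x∈ with ∈-applyUpTo⁻ suc x∈
... | _ , i<n , refl = s≤s z≤n , i<n

∈-range⁺ : ∀ {n} → InRange n x → x ∈ applyUpTo suc n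
∈-range⁺ {x = suc x} (_ , x<n) = ∈-applyUpTo⁺ suc x<n

range-unique : ∀ n → Unique (applyUpTo suc n)
range-unique n = Unique.applyUpTo⁺₁ suc n λ i<j _ → <⇒≢ (s≤s i<j)

concatMap-map≡cartesianProductWith : ∀ (f : A → B → C) xs ys →
  concatMap (λ x → map (f x) ys) xs ≡ cartesianProductWith f xs ys
concatMap-map≡cartesianProductWith f []       ys = refl
concatMap-map≡cartesianProductWith f (x ∷ xs) ys =
  cong (map (f x) ys ++_) (concatMap-map≡cartesianProductWith f xs ys)

words-suc : ∀ n k → words n (suc k) ≡ cartesianProductWith _∷_ (applyUpTo suc n) (words n k)
words-suc n k = concatMap-map≡cartesianProductWith _∷_ (applyUpTo suc n) (words n k)

∈-words⁻ : ∀ n k {w} → w ∈ words n k → length w ≡ k × All (InRange n) w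
∈-words⁻ n zero    (here refl) = refl , []
∈-words⁻ n (suc k) w∈
  with ∈-cartesianProductWith⁻ _∷_ (applyUpTo suc n) (words n k) (subst (_ ∈_) (words-suc n k) w∈)
... | a , w , a∈ , w∈′ , refl with ∈-words⁻ n k w∈′
...   | refl , w-range = refl , ∈-range⁻ a∈ ∷ w-range

∈-words⁺ : ∀ n {w} → All (InRange n) w → w ∈ words n (length w)
∈-words⁺ n []                           = here refl
∈-words⁺ n {a ∷ w} (a-range ∷ w-range) = subst (_ ∈_) (sym (words-suc n (length w)))
  (∈-cartesianProductWith⁺ _∷_ (∈-range⁺ a-range) (∈-words⁺ n w-range))

words-unique : ∀ n k → Unique (words n k)
words-unique n zero    = [] ∷ []
words-unique n (suc k) = subst Unique (sym (words-suc n k))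
  (Unique.cartesianProductWith⁺ _∷_ ∷-injective (range-unique n) (words-unique n k))

∈-Sym⁻ : ∀ {n π} → π ∈ Sym n → IsPerm n π
∈-Sym⁻ {n} π∈ with ∈-filter⁻ (UniqueDec.unique? _≟_) {xs = words n n} π∈
... | π∈words , uniq with ∈-words⁻ n n π∈words
...   | len , π-range = perm len π-range uniq

∈-Sym⁺ : ∀ {n π} → IsPerm n π → π ∈ Sym n
∈-Sym⁺ {n} (perm refl π-range uniq) =
  ∈-filter⁺ (UniqueDec.unique? _≟_) (∈-words⁺ n π-range) uniq

Sym-unique : ∀ n → Unique (Sym n)
Sym-unique n = Unique.filter⁺ (UniqueDec.unique? _≟_) (words-unique n n)

-- Occurrences of 231 as sublists

data Has231 (xs : List ℕ) : Set where
  occurrence : ∀ {a b c} → a ∷ b ∷ c ∷ [] ⊆ xs → c < a → a < b → Has231 xs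

lookup₂-⊆ : ∀ (xs : List A) {j k} → j <ᶠ k → lookup xs j ∷ lookup xs k ∷ [] ⊆ xs
lookup₂-⊆ (x ∷ xs) {zero}  {suc k} _         = refl ∷ from∈ (∈-lookup k)
lookup₂-⊆ (x ∷ xs) {suc j} {suc k} (s≤s j<k) = x ∷ʳ lookup₂-⊆ xs j<k

lookup₃-⊆ : ∀ (xs : List A) {i j k} → i <ᶠ j → j <ᶠ k →
  lookup xs i ∷ lookup xs j ∷ lookup xs k ∷ [] ⊆ xs
lookup₃-⊆ (x ∷ xs) {zero}  {suc j} {suc k} _         (s≤s j<k) = refl ∷ lookup₂-⊆ xs j<k
lookup₃-⊆ (x ∷ xs) {suc i} {suc j} {suc k} (s≤s i<j) (s≤s j<k) = x ∷ʳ lookup₃-⊆ xs i<j j<k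

⊆⇒index : ∀ {a zs} {xs : List A} → a ∷ zs ⊆ xs → Σ (Fin (length xs)) λ i → lookup xs i ≡ a
⊆⇒index (x ∷ʳ τ)   = let i , eq = ⊆⇒index τ in suc i , eq
⊆⇒index (refl ∷ _) = zero , refl

⊆⇒indices₂ : ∀ {a b} {xs : List A} → a ∷ b ∷ [] ⊆ xs →
  ∃₂ λ (i j : Fin (length xs)) → i <ᶠ j × lookup xs i ≡ a × lookup xs j ≡ b
⊆⇒indices₂ (x ∷ʳ τ) =
  let i , j , i<j , eqᵢ , eqⱼ = ⊆⇒indices₂ τ in suc i , suc j , s≤s i<j , eqᵢ , eqⱼ
⊆⇒indices₂ (refl ∷ τ) =
  let j , eqⱼ = ⊆⇒index τ in zero , suc j , s≤s z≤n , refl , eqⱼ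

⊆⇒indices₃ : ∀ {a b c} {xs : List A} → a ∷ b ∷ c ∷ [] ⊆ xs →
  ∃₂ λ (i j : Fin (length xs)) → ∃ λ k →
    i <ᶠ j × j <ᶠ k × lookup xs i ≡ a × lookup xs j ≡ b × lookup xs k ≡ c
⊆⇒indices₃ (x ∷ʳ τ) =
  let i , j , k , i<j , j<k , eqᵢ , eqⱼ , eqₖ = ⊆⇒indices₃ τ
  in suc i , suc j , suc k , s≤s i<j , s≤s j<k , eqᵢ , eqⱼ , eqₖ
⊆⇒indices₃ (refl ∷ τ) =
  let j , k , j<k , eqⱼ , eqₖ = ⊆⇒indices₂ τ
  in zero , suc j , suc k , s≤s z≤n , s≤s j<k , refl , eqⱼ , eqₖ

contains231⇒has231 : ∀ {xs} → Contains231 xs → Has231 xs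
contains231⇒has231 (i , j , k , i<j , j<k , c<a , a<b) =
  occurrence (lookup₃-⊆ _ i<j j<k) c<a a<b

has231⇒contains231 : ∀ {xs} → Has231 xs → Contains231 xs
has231⇒contains231 (occurrence τ c<a a<b) with ⊆⇒indices₃ τ
... | i , j , k , i<j , j<k , refl , refl , refl = i , j , k , i<j , j<k , c<a , a<b

avoids231-transfer : ∀ {xs ys} → (Has231 ys → Has231 xs) → Avoids231 xs → Avoids231 ys
avoids231-transfer ys⇒xs xs-avoids =
  xs-avoids ∘ has231⇒contains231 ∘ ys⇒xs ∘ contains231⇒has231

has231-⊆ : ∀ {xs ys} → xs ⊆ ys → Has231 xs → Has231 ys
has231-⊆ xs⊆ys (occurrence τ c<a a<b) = occurrence (⊆-trans τ xs⊆ys) c<a a<b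

⊆-++⁻ : ∀ (ys₁ : List A) {ys₂ xs} → xs ⊆ ys₁ ++ ys₂ →
  ∃₂ λ xs₁ xs₂ → xs ≡ xs₁ ++ xs₂ × xs₁ ⊆ ys₁ × xs₂ ⊆ ys₂
⊆-++⁻ []        τ          = [] , _ , refl , [] , τ
⊆-++⁻ (y ∷ ys₁) (.y ∷ʳ τ)  =
  let xs₁ , xs₂ , eq , τ₁ , τ₂ = ⊆-++⁻ ys₁ τ in xs₁ , xs₂ , eq , y ∷ʳ τ₁ , τ₂
⊆-++⁻ (y ∷ ys₁) (refl ∷ τ) with ⊆-++⁻ ys₁ τ
... | xs₁ , xs₂ , refl , τ₁ , τ₂ = y ∷ xs₁ , xs₂ , refl , refl ∷ τ₁ , τ₂

⊆-map⁻ : ∀ (f : A → B) ys {zs} → zs ⊆ map f ys → ∃ λ xs → xs ⊆ ys × zs ≡ map f xs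
⊆-map⁻ f []       []         = [] , [] , refl
⊆-map⁻ f (y ∷ ys) (_ ∷ʳ τ)   = let xs , τ′ , eq = ⊆-map⁻ f ys τ in xs , y ∷ʳ τ′ , eq
⊆-map⁻ f (y ∷ ys) (refl ∷ τ) with ⊆-map⁻ f ys τ
... | xs , τ′ , refl = y ∷ xs , refl ∷ τ′ , refl

has231-map⁺ : ∀ {f xs} → (∀ {x y} → x < y → f x < f y) → Has231 xs → Has231 (map f xs)
has231-map⁺ {f} f-mono (occurrence τ c<a a<b) =
  occurrence (map⁺ f τ) (f-mono c<a) (f-mono a<b)

has231-map⁻ : ∀ {f} xs → (∀ {x y} → f x < f y → x < y) → Has231 (map f xs) → Has231 xs
has231-map⁻ {f} xs f-reflects (occurrence τ c<a a<b) with ⊆-map⁻ f xs τ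
... | _ ∷ _ ∷ _ ∷ [] , τ′ , refl = occurrence τ′ (f-reflects c<a) (f-reflects a<b)

has231-++-[]⁻ : ∀ {e} xs → All (_≤ suc e) xs → Has231 (xs ++ [ e ]) → Has231 xs
has231-++-[]⁻ xs xs≤ (occurrence τ c<a a<b) with ⊆-++⁻ xs τ
... | _ ∷ _ ∷ _ ∷ [] , [] , refl , τ₁ , _ = occurrence τ₁ c<a a<b
... | _ ∷ _ ∷ [] , _ ∷ [] , refl , τ₁ , refl ∷ [] =
  ⊥-elim (<⇒≱ a<b (≤-trans (All.lookup xs≤ (⊆-lookup τ₁ (there (here refl)))) c<a))
... | _ ∷ [] , _ ∷ _ ∷ [] , refl , _ , _ ∷ ()
... | [] , _ ∷ _ ∷ _ ∷ [] , refl , _ , _ ∷ ()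

has231-insert⁻ : ∀ {x m} as {bs} → All (_< m) as → All (_≤ m) bs → m < x →
  Has231 (as ++ x ∷ m ∷ bs) → Has231 (as ++ m ∷ bs)
has231-insert⁻ as as<m bs≤m m<x (occurrence τ c<a a<b) with ⊆-++⁻ as τ
... | _ ∷ _ ∷ _ ∷ [] , [] , refl , τ₁ , _ = occurrence (++⁺ʳ _ τ₁) c<a a<b
... | _ ∷ _ ∷ [] , _ ∷ [] , refl , τ₁ , _ ∷ʳ τ₂ = occurrence (++⁺ τ₁ τ₂) c<a a<b
... | _ ∷ _ ∷ [] , _ ∷ [] , refl , τ₁ , refl ∷ _ =
  ⊥-elim (<-asym (<-trans (All.lookup as<m (⊆-lookup τ₁ (here refl))) m<x) c<a)
... | _ ∷ [] , _ ∷ _ ∷ [] , refl , τ₁ , _ ∷ʳ τ₂ = occurrence (++⁺ τ₁ τ₂) c<a a<b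
... | _ ∷ [] , _ ∷ _ ∷ [] , refl , τ₁ , refl ∷ (_ ∷ʳ τ₂) =
  occurrence (++⁺ τ₁ (refl ∷ τ₂)) c<a (All.lookup as<m (⊆-lookup τ₁ (here refl)))
... | _ ∷ [] , _ ∷ _ ∷ [] , refl , τ₁ , refl ∷ (refl ∷ _) =
  ⊥-elim (<-asym (All.lookup as<m (⊆-lookup τ₁ (here refl))) c<a)
... | [] , _ ∷ _ ∷ _ ∷ [] , refl , _ , _ ∷ʳ τ₂ = occurrence (++⁺ˡ as τ₂) c<a a<b
... | [] , _ ∷ _ ∷ _ ∷ [] , refl , _ , refl ∷ τ₂ =
  ⊥-elim (<⇒≱ (<-trans m<x a<b) (All.lookup (≤-refl ∷ bs≤m) (⊆-lookup τ₂ (here refl))))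

app-∈ : ∀ xs {i} → i < length xs → app xs (suc i) ∈ xs
app-∈ (x ∷ xs) {zero}  _         = here refl
app-∈ (x ∷ xs) {suc i} (s≤s i<n) = there (app-∈ xs i<n)

∈⇒app : ∀ {xs} {x : ℕ} → x ∈ xs → ∃ λ i → i < length xs × app xs (suc i) ≡ x
∈⇒app (here refl) = zero , s≤s z≤n , refl
∈⇒app (there x∈)  = let i , i<n , eq = ∈⇒app x∈ in suc i , s≤s i<n , eq

app-injective : ∀ {xs i j} → Unique xs → i < length xs → j < length xs →
  app xs (suc i) ≡ app xs (suc j) → i ≡ j
app-injective {x ∷ xs} {zero}  {zero}  _           _         _         _  = refl
app-injective {x ∷ xs} {zero}  {suc j} (x∉xs ∷ _) _         (s≤s j<n) eq =
  ⊥-elim (All.lookup x∉xs (app-∈ xs j<n) eq)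
app-injective {x ∷ xs} {suc i} {zero}  (x∉xs ∷ _) (s≤s i<n) _         eq =
  ⊥-elim (All.lookup x∉xs (app-∈ xs i<n) (sym eq))
app-injective {x ∷ xs} {suc i} {suc j} (_ ∷ uniq) (s≤s i<n) (s≤s j<n) eq =
  cong suc (app-injective uniq i<n j<n eq)

app-++ˡ : ∀ xs {ys i} → i < length xs → app (xs ++ ys) (suc i) ≡ app xs (suc i)
app-++ˡ (x ∷ xs) {i = zero}  _         = refl
app-++ˡ (x ∷ xs) {i = suc i} (s≤s i<n) = app-++ˡ xs i<n

app-++-[] : ∀ xs {x} → app (xs ++ [ x ]) (suc (length xs)) ≡ x
app-++-[] []           = refl
app-++-[] (_ ∷ [])     = refl
app-++-[] (_ ∷ y ∷ xs) = app-++-[] (y ∷ xs)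

app-map : ∀ f xs {i} → i < length xs → app (map f xs) (suc i) ≡ f (app xs (suc i))
app-map f (x ∷ xs) {zero}  _         = refl
app-map f (x ∷ xs) {suc i} (s≤s i<n) = app-map f xs i<n

app-⊆ : ∀ xs {i j} → i < j → j < length xs → app xs (suc i) ∷ app xs (suc j) ∷ [] ⊆ xs
app-⊆ (x ∷ xs) {zero}  {suc j} _         (s≤s j<n) = refl ∷ from∈ (app-∈ xs j<n)
app-⊆ (x ∷ xs) {suc i} {suc j} (s≤s i<j) (s≤s j<n) = x ∷ʳ app-⊆ xs i<j j<n

app-⊆₃ : ∀ xs {i j k} → i < j → j < k → k < length xs →
  app xs (suc i) ∷ app xs (suc j) ∷ app xs (suc k) ∷ [] ⊆ xs
app-⊆₃ (x ∷ xs) {zero}  {suc j} {suc k} _         (s≤s j<k) (s≤s k<n) =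
  refl ∷ app-⊆ xs j<k k<n
app-⊆₃ (x ∷ xs) {suc i} {suc j} {suc k} (s≤s i<j) (s≤s j<k) (s≤s k<n) =
  x ∷ʳ app-⊆₃ xs i<j j<k k<n

applyUpTo-⊆ : ∀ (f : ℕ → A) {i j p} → i < j → j < p → f i ∷ f j ∷ [] ⊆ applyUpTo f p
applyUpTo-⊆ f {zero}  {suc j} {suc p} _         (s≤s j<p) =
  refl ∷ from∈ (∈-applyUpTo⁺ (f ∘ suc) j<p)
applyUpTo-⊆ f {suc i} {suc j} {suc p} (s≤s i<j) (s≤s j<p) =
  f 0 ∷ʳ applyUpTo-⊆ (f ∘ suc) i<j j<p

iterate-+ : ∀ (f : A → A) x i j → iterate f x (i + j) ≡ iterate f (iterate f x i) j
iterate-+ f x zero    j = refl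
iterate-+ f x (suc i) j = iterate-+ f (f x) i j

iterate-suc : ∀ (f : A → A) x i → iterate f x (suc i) ≡ f (iterate f x i)
iterate-suc f x zero    = refl
iterate-suc f x (suc i) = iterate-suc f (f x) i

iterate-periodic : ∀ (f : A → A) {x p} → iterate f x p ≡ x → ∀ q → iterate f x (q * p) ≡ x
iterate-periodic f         fᵖx≡x zero    = refl
iterate-periodic f {x} {p} fᵖx≡x (suc q) = begin
  iterate f x (p + q * p)           ≡⟨ iterate-+ f x p (q * p) ⟩
  iterate f (iterate f x p) (q * p) ≡⟨ cong (λ y → iterate f y (q * p)) fᵖx≡x ⟩
  iterate f x (q * p)               ≡⟨ iterate-periodic f fᵖx≡x q ⟩
  x                                 ∎
  where open ≡-Reasoning

iterate-% : ∀ (f : A → A) {x} p .{{_ : NonZero p}} → iterate f x p ≡ x →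
  ∀ t → iterate f x t ≡ iterate f x (t % p)
iterate-% f {x} p fᵖx≡x t = begin
  iterate f x t
    ≡⟨ cong (iterate f x) (trans (m≡m%n+[m/n]*n t p) (+-comm (t % p) _)) ⟩
  iterate f x (t / p * p + t % p)
    ≡⟨ iterate-+ f x (t / p * p) (t % p) ⟩
  iterate f (iterate f x (t / p * p)) (t % p)
    ≡⟨ cong (λ y → iterate f y (t % p)) (iterate-periodic f fᵖx≡x (t / p)) ⟩
  iterate f x (t % p)
    ∎
  where open ≡-Reasoning

record FirstHit (f : ℕ → ℕ) (x y r : ℕ) : Set where
  field
    hits   : iterate f x r ≡ y
    misses : ∀ {t} → t < r → iterate f x t ≢ y

firstHit? : ∀ f x y k →
  (∃ λ r → r < k × FirstHit f x y r) ⊎ (∀ {t} → t < k → iterate f x t ≢ y)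
firstHit? f x y zero    = inj₂ λ ()
firstHit? f x y (suc k) with firstHit? f x y k
... | inj₁ (r , r<k , hit) = inj₁ (r , m<n⇒m<1+n r<k , hit)
... | inj₂ misses with iterate f x k ≟ y
...   | yes hits = inj₁ (k , ≤-refl , record { hits = hits ; misses = misses })
...   | no  miss = inj₂ λ t<1+k → [ misses , (λ { refl → miss }) ]′ (m<1+n⇒m<n∨m≡n t<1+k)

orbitFrom-stop : ∀ π m f → orbitFrom π m f m ≡ []
orbitFrom-stop π m zero    = refl
orbitFrom-stop π m (suc f) with m ≟ m
... | yes _   = refl
... | no  m≢m = ⊥-elim (m≢m refl)

orbitFrom-step : ∀ π {m x} f → x ≢ m → orbitFrom π m (suc f) x ≡ x ∷ orbitFrom π m f (app π x)
orbitFrom-step π {m} {x} f x≢m with x ≟ m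
... | yes x≡m = ⊥-elim (x≢m x≡m)
... | no  _   = refl

orbitFrom-∌ : ∀ π m f x → m ∉ orbitFrom π m f x
orbitFrom-∌ π m zero    x ()
orbitFrom-∌ π m (suc f) x m∈ with x ≟ m
orbitFrom-∌ π m (suc f) x ()         | yes _
orbitFrom-∌ π m (suc f) x (here m≡x) | no  x≢m = x≢m (sym m≡x)
orbitFrom-∌ π m (suc f) x (there m∈) | no  _   = orbitFrom-∌ π m f (app π x) m∈

orbitFrom≡applyUpTo : ∀ π {m f x r} → FirstHit (app π) x m r → r ≤ f →
  orbitFrom π m f x ≡ applyUpTo (iterate (app π) x) r
orbitFrom≡applyUpTo π {f = f}     {r = zero}  record { hits = refl } _ = orbitFrom-stop π _ f
orbitFrom≡applyUpTo π {f = suc f} {r = suc r} hit (s≤s r≤f) =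
  trans (orbitFrom-step π f (misses (s≤s z≤n)))
        (cong (_ ∷_) (orbitFrom≡applyUpTo π (record { hits = hits ; misses = misses ∘ s≤s }) r≤f))
  where open FirstHit hit

orbitFrom-cong : ∀ (P : ℕ → Set) π₁ π₂ {m} →
  (∀ {y} → P y → app π₁ y ≡ app π₂ y) → (∀ {y} → P y → P (app π₁ y)) →
  ∀ f {x} → P x → orbitFrom π₁ m f x ≡ orbitFrom π₂ m f x
orbitFrom-cong P π₁ π₂     agree closed zero    _  = refl
orbitFrom-cong P π₁ π₂ {m} agree closed (suc f) {x} Px with x ≟ m
... | yes _ = refl
... | no  _ = cong (x ∷_) (trans (orbitFrom-cong P π₁ π₂ agree closed f (closed Px))
                                 (cong (orbitFrom π₂ m f) (agree Px)))

module Perm {n π} (isPerm : IsPerm n π) where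
  open IsPerm isPerm

  σ : ℕ → ℕ
  σ = app π

  private
    <n⇒<length : ∀ {i} → i < n → i < length π
    <n⇒<length {i} = subst (i <_) (sym length≡)

  σ-range : InRange n y → InRange n (σ y)
  σ-range {suc i} (_ , i<n) = All.lookup inRange (app-∈ π (<n⇒<length i<n))

  σ-injective : InRange n x → InRange n y → σ x ≡ σ y → x ≡ y
  σ-injective {suc i} {suc j} (_ , i<n) (_ , j<n) eq =
    cong suc (app-injective unique (<n⇒<length i<n) (<n⇒<length j<n) eq)

  σ-surjective : InRange n y → ∃ λ x → InRange n x × σ x ≡ y
  σ-surjective {y} y-range with y ∈? π
  ... | yes y∈π = let i , i<n , eq = ∈⇒app y∈π in
    suc i , (s≤s z≤n , subst (i <_) length≡ i<n) , eq
  ... | no  y∉π = ⊥-elim (1+n≰n (subst₂ _≤_ (cong suc length≡) (length-applyUpTo suc n)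
    (unique⇒length-≤ (¬Any⇒All¬ π y∉π ∷ unique) λ where
      (here refl) → ∈-range⁺ y-range
      (there z∈)  → ∈-range⁺ (All.lookup inRange z∈))))

  iterate-range : InRange n x → ∀ t → InRange n (iterate σ x t)
  iterate-range x-range zero    = x-range
  iterate-range x-range (suc t) = iterate-range (σ-range x-range) t

  iterate-injective : InRange n x → InRange n y → ∀ t → iterate σ x t ≡ iterate σ y t → x ≡ y
  iterate-injective x-range y-range zero    eq = eq
  iterate-injective x-range y-range (suc t) eq =
    σ-injective x-range y-range (iterate-injective (σ-range x-range) (σ-range y-range) t eq)

  -- Pigeonhole: the n + 1 iterates m, σ m, …, σⁿ m cannot be distinct elements of [n].
  firstReturn : InRange n m → ∃ λ r → r < n × FirstHit σ (σ m) m r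
  firstReturn {m} m-range with firstHit? σ (σ m) m n
  ... | inj₁ found  = found
  ... | inj₂ misses = ⊥-elim (1+n≰n
    (subst₂ _≤_ (length-applyUpTo (iterate σ m) (suc n)) (length-applyUpTo suc n)
      (unique⇒length-≤ (Unique.applyUpTo⁺₁ (iterate σ m) (suc n) distinct) iterates-in-range)))
    where
    open ≡-Reasoning
    distinct : ∀ {i j} → i < j → j < suc n → iterate σ m i ≢ iterate σ m j
    distinct {i} i<j j<1+n eq with m≤n⇒∃[o]m+o≡n i<j
    ... | o , refl = misses (≤-<-trans (m≤n+m o i) (≤-pred j<1+n))
      (sym (iterate-injective m-range (iterate-range m-range (suc o)) i (begin
        iterate σ m i                   ≡⟨ eq ⟩
        iterate σ (σ m) (i + o)         ≡⟨ cong (iterate σ (σ m)) (+-comm i o) ⟩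
        iterate σ (σ m) (o + i)         ≡⟨ iterate-+ σ (σ m) o i ⟩
        iterate σ (iterate σ (σ m) o) i ∎)))
    iterates-in-range : applyUpTo (iterate σ m) (suc n) ⊆ₛ applyUpTo suc n
    iterates-in-range z∈ with ∈-applyUpTo⁻ (iterate σ m) z∈
    ... | t , _ , refl = ∈-range⁺ (iterate-range m-range t)

  cycleOf-≡ : ∀ m → cycleOf π m ≡ m ∷ orbitFrom π m n (σ m)
  cycleOf-≡ m = cong (λ f → m ∷ orbitFrom π m f (σ m)) length≡

  orbitFrom-fuel : InRange n m → ∀ {f} → n ≤ f → orbitFrom π m f (σ m) ≡ orbitFrom π m n (σ m)
  orbitFrom-fuel m-range n≤f with firstReturn m-range
  ... | r , r<n , hit = trans (orbitFrom≡applyUpTo π hit (≤-trans (<⇒≤ r<n) n≤f))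
                              (sym (orbitFrom≡applyUpTo π hit (<⇒≤ r<n)))

  cycleOf≡applyUpTo : InRange n m →
    ∃ λ r → iterate σ m (suc r) ≡ m × cycleOf π m ≡ applyUpTo (iterate σ m) (suc r)
  cycleOf≡applyUpTo {m} m-range with firstReturn m-range
  ... | r , r<n , hit = r , FirstHit.hits hit ,
    trans (cycleOf-≡ m) (cong (m ∷_) (orbitFrom≡applyUpTo π hit (<⇒≤ r<n)))

  ∈-cycleOf⁻ : InRange n m → y ∈ cycleOf π m → ∃ λ t → iterate σ m t ≡ y
  ∈-cycleOf⁻ {m} {y} m-range y∈ with cycleOf≡applyUpTo m-range
  ... | r , _ , cycle≡ =
    let t , _ , y≡ = ∈-applyUpTo⁻ (iterate σ m) (subst (y ∈_) cycle≡ y∈) in t , sym y≡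

  iterate-∈-cycleOf : InRange n m → ∀ t → iterate σ m t ∈ cycleOf π m
  iterate-∈-cycleOf {m} m-range t with cycleOf≡applyUpTo m-range
  ... | r , periodic , cycle≡ = subst₂ _∈_ (sym (iterate-% σ (suc r) periodic t)) (sym cycle≡)
                                       (∈-applyUpTo⁺ (iterate σ m) (m%n<n t (suc r)))

  cycleOf-range : InRange n m → All (InRange n) (cycleOf π m)
  cycleOf-range m-range = All.tabulate λ y∈ →
    let t , eq = ∈-cycleOf⁻ m-range y∈ in subst (InRange n) eq (iterate-range m-range t)

  ∈-cycleOf-sym : InRange n x → y ∈ cycleOf π x → x ∈ cycleOf π y
  ∈-cycleOf-sym {x} x-range y∈ with ∈-cycleOf⁻ x-range y∈ | cycleOf≡applyUpTo x-range
  ... | t , refl | r , periodic , _ =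
    subst (_∈ cycleOf π _) returns-to-x (iterate-∈-cycleOf (iterate-range x-range t) (t * r))
    where
    open ≡-Reasoning
    returns-to-x : iterate σ (iterate σ x t) (t * r) ≡ x
    returns-to-x = begin
      iterate σ (iterate σ x t) (t * r) ≡⟨ iterate-+ σ x t (t * r) ⟨
      iterate σ x (t + t * r)           ≡⟨ cong (iterate σ x) (*-suc t r) ⟨
      iterate σ x (t * suc r)           ≡⟨ iterate-periodic σ periodic t ⟩
      x                                 ∎

block : List ℕ → ℕ → List ℕ
block π m = if isCycleMax π m then cycleOf π m else []

blocksUpTo : List ℕ → ℕ → List ℕ
blocksUpTo π k = concatMap (block π) (applyUpTo suc k)

block-≤ : ∀ π m → All (_≤ m) (block π m)
block-≤ π m with isCycleMax π m in isMax
... | true  = All.map (≤ᵇ⇒≤ _ m) (all⁺ (_≤ᵇ m) (cycleOf π m) (subst T (sym isMax) _))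
... | false = []

block-max : ∀ π m → All (_≤ m) (cycleOf π m) → block π m ≡ cycleOf π m
block-max π m cycle≤m with isCycleMax π m in isMax
... | true  = refl
... | false = ⊥-elim (subst T isMax (all⁻ (_≤ᵇ m) (All.map ≤⇒≤ᵇ cycle≤m)))

block-nonmax : ∀ π {m z} → z ∈ cycleOf π m → m < z → block π m ≡ []
block-nonmax π {m} z∈ m<z with isCycleMax π m in isMax
... | true  = ⊥-elim (<⇒≱ m<z (≤ᵇ⇒≤ _ m
                (All.lookup (all⁺ (_≤ᵇ m) (cycleOf π m) (subst T (sym isMax) _)) z∈)))
... | false = refl

block-cong : ∀ π₁ π₂ {m} → cycleOf π₁ m ≡ cycleOf π₂ m → block π₁ m ≡ block π₂ m
block-cong π₁ π₂ {m} = cong (λ c → if all (_≤ᵇ m) c then c else [])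

blocksUpTo-suc : ∀ π k → blocksUpTo π (suc k) ≡ blocksUpTo π k ++ block π (suc k)
blocksUpTo-suc π k = begin
  concatMap (block π) (applyUpTo suc (suc k))
    ≡⟨ cong (concatMap (block π)) (applyUpTo-∷ʳ suc k) ⟨
  concatMap (block π) (applyUpTo suc k ++ [ suc k ])
    ≡⟨ concatMap-++ (block π) (applyUpTo suc k) [ suc k ] ⟩
  blocksUpTo π k ++ (block π (suc k) ++ [])
    ≡⟨ cong (blocksUpTo π k ++_) (++-identityʳ (block π (suc k))) ⟩
  blocksUpTo π k ++ block π (suc k)
    ∎
  where open ≡-Reasoning

blocksUpTo-≤ : ∀ π k → All (_≤ k) (blocksUpTo π k)
blocksUpTo-≤ π zero    = []
blocksUpTo-≤ π (suc k) = subst (All (_≤ suc k)) (sym (blocksUpTo-suc π k))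
  (All-++⁺ (All.map m≤n⇒m≤1+n (blocksUpTo-≤ π k)) (block-≤ π (suc k)))

blocksUpTo-cong : ∀ π₁ π₂ k → (∀ {m} → InRange k m → block π₁ m ≡ block π₂ m) →
  blocksUpTo π₁ k ≡ blocksUpTo π₂ k
blocksUpTo-cong π₁ π₂ zero    _     = refl
blocksUpTo-cong π₁ π₂ (suc k) agree = begin
  blocksUpTo π₁ (suc k)                ≡⟨ blocksUpTo-suc π₁ k ⟩
  blocksUpTo π₁ k ++ block π₁ (suc k)  ≡⟨ cong₂ _++_ (blocksUpTo-cong π₁ π₂ k agree-below)
                                                      (agree (s≤s z≤n , ≤-refl)) ⟩
  blocksUpTo π₂ k ++ block π₂ (suc k)  ≡⟨ blocksUpTo-suc π₂ k ⟨
  blocksUpTo π₂ (suc k)                ∎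
  where
  open ≡-Reasoning
  agree-below : ∀ {m} → InRange k m → block π₁ m ≡ block π₂ m
  agree-below (0<m , m≤k) = agree (0<m , m≤n⇒m≤1+n m≤k)

-- Relabelling n as n + 1

punchIn : ℕ → ℕ → ℕ
punchIn n y with y <? n
... | yes _ = y
... | no  _ = suc y

punchOut : ℕ → ℕ → ℕ
punchOut n y with y <? n
... | yes _ = y
... | no  _ = pred y

punchIn-< : ∀ {y n} → y < n → punchIn n y ≡ y
punchIn-< {y} {n} y<n with y <? n
... | yes _   = refl
... | no  y≮n = ⊥-elim (y≮n y<n)

punchIn-≥ : ∀ {n y} → n ≤ y → punchIn n y ≡ suc y
punchIn-≥ {n} {y} n≤y with y <? n
... | yes y<n = ⊥-elim (<⇒≱ y<n n≤y)
... | no  _   = refl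

punchIn-mono : ∀ {x y n} → x < y → punchIn n x < punchIn n y
punchIn-mono {x} {y} {n} x<y with x <? n | y <? n
... | yes _   | yes _   = x<y
... | yes _   | no  _   = m<n⇒m<1+n x<y
... | no  x≮n | yes y<n = ⊥-elim (x≮n (<-trans x<y y<n))
... | no  _   | no  _   = s≤s x<y

punchIn-reflects : ∀ {n x y} → punchIn n x < punchIn n y → x < y
punchIn-reflects {n} {x} {y} lt with <-cmp x y
... | tri< x<y _ _  = x<y
... | tri≈ _ refl _ = ⊥-elim (<-irrefl refl lt)
... | tri> _ _ y<x  = ⊥-elim (<-asym lt (punchIn-mono y<x))

punchIn-injective : ∀ {n x y} → punchIn n x ≡ punchIn n y → x ≡ y
punchIn-injective {n} {x} {y} eq with <-cmp x y
... | tri< x<y _ _ = ⊥-elim (<⇒≢ (punchIn-mono x<y) eq)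
... | tri≈ _ x≡y _ = x≡y
... | tri> _ _ y<x = ⊥-elim (<⇒≢ (punchIn-mono y<x) (sym eq))

punchIn≢ : ∀ {n y} → punchIn n y ≢ n
punchIn≢ {n} {y} with y <? n
... | yes y<n = <⇒≢ y<n
... | no  y≮n = λ { refl → y≮n ≤-refl }

punchIn-range : ∀ {n y} → InRange n y → InRange (suc n) (punchIn n y)
punchIn-range {n} {y} (0<y , y≤n) with y <? n
... | yes _ = 0<y , m≤n⇒m≤1+n y≤n
... | no  _ = s≤s z≤n , s≤s y≤n

punchIn-punchOut : ∀ {y n} → y ≢ n → punchIn n (punchOut n y) ≡ y
punchIn-punchOut {y} {n} y≢n with y <? n
... | yes y<n = punchIn-< y<n
punchIn-punchOut {suc y} {n} y≢n | no y≮n = punchIn-≥ (≤-pred (≤∧≢⇒< (≮⇒≥ y≮n) (y≢n ∘ sym)))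
punchIn-punchOut {zero}  {n} y≢n | no y≮n = ⊥-elim (y≢n (sym (n≤0⇒n≡0 (≮⇒≥ y≮n))))

punchOut-range : ∀ {n y} → 0 < n → InRange (suc n) y → y ≢ n → InRange n (punchOut n y)
punchOut-range {n} {y} 0<n (0<y , y≤1+n) y≢n with y <? n
... | yes y<n = 0<y , <⇒≤ y<n
punchOut-range {n} {suc y} 0<n (_ , s≤s y≤n) y≢n | no y≮n =
  ≤-trans 0<n (≤-pred (≤∧≢⇒< (≮⇒≥ y≮n) (y≢n ∘ sym))) , y≤n

-- The two extensions of a permutation of [n]

extendTop : ℕ → List ℕ → List ℕ
extendTop n π = π ++ [ suc n ]

extendNext : ℕ → List ℕ → List ℕ
extendNext n π = map (punchIn n) π ++ [ n ]

module ExtendTop {n π} (isPerm : IsPerm n π) where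
  open IsPerm isPerm
  open Perm isPerm

  ρ : List ℕ
  ρ = extendTop n π

  ρ-perm : IsPerm (suc n) ρ
  ρ-perm = perm (trans (length-++-[] π) (cong suc length≡))
    (All-++⁺ (All.map (λ (0<y , y≤n) → 0<y , m≤n⇒m≤1+n y≤n) inRange) ((s≤s z≤n , ≤-refl) ∷ []))
    (Unique.++⁺ unique ([] ∷ []) λ { (1+n∈π , here refl) →
      1+n≰n (proj₂ (All.lookup inRange 1+n∈π)) })

  app-ρ : InRange n y → app ρ y ≡ σ y
  app-ρ {suc i} (_ , i<n) = app-++ˡ π (subst (i <_) (sym length≡) i<n)

  app-ρ-top : app ρ (suc n) ≡ suc n
  app-ρ-top = subst (λ l → app ρ (suc l) ≡ suc n) length≡ (app-++-[] π)

  cycleOf-ρ : InRange n m → cycleOf ρ m ≡ cycleOf π m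
  cycleOf-ρ {m} m-range = begin
    cycleOf ρ m                          ≡⟨ Perm.cycleOf-≡ ρ-perm m ⟩
    m ∷ orbitFrom ρ m (suc n) (app ρ m)  ≡⟨ cong (λ x → m ∷ orbitFrom ρ m (suc n) x) (app-ρ m-range) ⟩
    m ∷ orbitFrom ρ m (suc n) (σ m)      ≡⟨ cong (m ∷_) (orbitFrom-cong (InRange n) ρ π app-ρ closed
                                                           (suc n) (σ-range m-range)) ⟩
    m ∷ orbitFrom π m (suc n) (σ m)      ≡⟨ cong (m ∷_) (orbitFrom-fuel m-range (n≤1+n n)) ⟩
    m ∷ orbitFrom π m n (σ m)            ≡⟨ cycleOf-≡ m ⟨
    cycleOf π m                          ∎
    where
    open ≡-Reasoning
    closed : ∀ {y} → InRange n y → InRange n (app ρ y)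
    closed y-range = subst (InRange n) (sym (app-ρ y-range)) (σ-range y-range)

  cycleOf-ρ-top : cycleOf ρ (suc n) ≡ [ suc n ]
  cycleOf-ρ-top = trans (Perm.cycleOf-≡ ρ-perm (suc n)) (cong (suc n ∷_)
    (trans (cong (orbitFrom ρ (suc n) (suc n)) app-ρ-top) (orbitFrom-stop ρ (suc n) (suc n))))

  θ-ρ : θ ρ ≡ θ π ++ [ suc n ]
  θ-ρ = begin
    blocksUpTo ρ (length ρ)               ≡⟨ cong (blocksUpTo ρ) (IsPerm.length≡ ρ-perm) ⟩
    blocksUpTo ρ (suc n)                  ≡⟨ blocksUpTo-suc ρ n ⟩
    blocksUpTo ρ n ++ block ρ (suc n)     ≡⟨ cong₂ _++_ (blocksUpTo-cong ρ π n (block-cong ρ π ∘ cycleOf-ρ))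
                                                        (trans (block-max ρ (suc n) top≤) cycleOf-ρ-top) ⟩
    blocksUpTo π n ++ [ suc n ]           ≡⟨ cong (λ l → blocksUpTo π l ++ [ suc n ]) length≡ ⟨
    blocksUpTo π (length π) ++ [ suc n ]  ∎
    where
    open ≡-Reasoning
    top≤ : All (_≤ suc n) (cycleOf ρ (suc n))
    top≤ = subst (All (_≤ suc n)) (sym cycleOf-ρ-top) (≤-refl ∷ [])

  θπ≤n : All (_≤ n) (θ π)
  θπ≤n = subst (λ l → All (_≤ l) (θ π)) length≡ (blocksUpTo-≤ π (length π))

  avoids-ρ : Avoids231 π → Avoids231 ρ
  avoids-ρ = avoids231-transfer {π} {ρ}
    (has231-++-[]⁻ π (All.map (λ (_ , y≤n) → m≤n⇒m≤1+n (m≤n⇒m≤1+n y≤n)) inRange))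

  avoids-θρ : Avoids231 (θ π) → Avoids231 (θ ρ)
  avoids-θρ = avoids231-transfer {θ π} {θ ρ}
    (has231-++-[]⁻ (θ π) (All.map (m≤n⇒m≤1+n ∘ m≤n⇒m≤1+n) θπ≤n) ∘ subst Has231 θ-ρ)

  avoids-ρ⁻ : Avoids231 ρ → Avoids231 π
  avoids-ρ⁻ = avoids231-transfer {ρ} {π} (has231-⊆ (++⁺ʳ _ ⊆-refl))

  avoids-θρ⁻ : Avoids231 (θ ρ) → Avoids231 (θ π)
  avoids-θρ⁻ = avoids231-transfer {θ ρ} {θ π} (subst Has231 (sym θ-ρ) ∘ has231-⊆ (++⁺ʳ _ ⊆-refl))

module ExtendNext {k π} (isPerm : IsPerm (suc k) π) where
  open IsPerm isPerm
  open Perm isPerm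

  n : ℕ
  n = suc k

  g : List ℕ
  g = extendNext n π

  n-range : InRange n n
  n-range = s≤s z≤n , ≤-refl

  length-map-π : length (map (punchIn n) π) ≡ n
  length-map-π = trans (length-map (punchIn n) π) length≡

  g-perm : IsPerm (suc n) g
  g-perm = perm (trans (length-++-[] (map (punchIn n) π)) (cong suc length-map-π))
    (All-++⁺ (All-map⁺ (All.map punchIn-range inRange)) ((s≤s z≤n , n≤1+n n) ∷ []))
    (Unique.++⁺ (Unique.map⁺ punchIn-injective unique) ([] ∷ []) λ { (n∈ , here refl) →
      let y , _ , n≡ = ∈-map⁻ (punchIn n) n∈ in punchIn≢ {n} {y} (sym n≡) })

  app-g : InRange n y → app g y ≡ punchIn n (σ y)
  app-g {suc i} (_ , i<n) =
    trans (app-++ˡ (map (punchIn n) π) (subst (i <_) (sym length-map-π) i<n))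
          (app-map (punchIn n) π (subst (i <_) (sym length≡) i<n))

  app-g-top : app g (suc n) ≡ n
  app-g-top = subst (λ l → app g (suc l) ≡ n) length-map-π (app-++-[] (map (punchIn n) π))

  orbitFrom-g : InRange n m → ∀ f {x} → InRange n x → n ∉ orbitFrom π m f x →
    orbitFrom g (punchIn n m) f (punchIn n x) ≡ orbitFrom π m f x
  orbitFrom-g m-range zero    _       _  = refl
  orbitFrom-g {m} m-range (suc f) {x} x-range n∉ with x ≟ m
  ... | yes refl = orbitFrom-stop g (punchIn n x) (suc f)
  ... | no  x≢m  = begin
    orbitFrom g (punchIn n m) (suc f) (punchIn n x)
      ≡⟨ cong (orbitFrom g (punchIn n m) (suc f)) x-fixed ⟩
    orbitFrom g (punchIn n m) (suc f) x
      ≡⟨ orbitFrom-step g f (x≢m ∘ punchIn-injective ∘ trans x-fixed) ⟩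
    x ∷ orbitFrom g (punchIn n m) f (app g x)
      ≡⟨ cong (λ y → x ∷ orbitFrom g (punchIn n m) f y) (app-g x-range) ⟩
    x ∷ orbitFrom g (punchIn n m) f (punchIn n (σ x))
      ≡⟨ cong (x ∷_) (orbitFrom-g m-range f (σ-range x-range) (n∉ ∘ there)) ⟩
    x ∷ orbitFrom π m f (σ x)
      ∎
    where
    open ≡-Reasoning
    x-fixed : punchIn n x ≡ x
    x-fixed = punchIn-< (≤∧≢⇒< (proj₂ x-range) (n∉ ∘ here ∘ sym))

  cycleOf-g-top : cycleOf g (suc n) ≡ suc n ∷ cycleOf π n
  cycleOf-g-top = begin
    cycleOf g (suc n)
      ≡⟨ Perm.cycleOf-≡ g-perm (suc n) ⟩
    suc n ∷ orbitFrom g (suc n) (suc n) (app g (suc n))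
      ≡⟨ cong (λ y → suc n ∷ orbitFrom g (suc n) (suc n) y) app-g-top ⟩
    suc n ∷ orbitFrom g (suc n) (suc n) n
      ≡⟨ cong (suc n ∷_) (orbitFrom-step g n (<⇒≢ ≤-refl)) ⟩
    suc n ∷ n ∷ orbitFrom g (suc n) n (app g n)
      ≡⟨ cong (λ y → suc n ∷ n ∷ orbitFrom g (suc n) n y) (app-g n-range) ⟩
    suc n ∷ n ∷ orbitFrom g (suc n) n (punchIn n (σ n))
      ≡⟨ cong (λ l → suc n ∷ n ∷ orbitFrom g l n (punchIn n (σ n))) (punchIn-≥ ≤-refl) ⟨
    suc n ∷ n ∷ orbitFrom g (punchIn n n) n (punchIn n (σ n))
      ≡⟨ cong (λ o → suc n ∷ n ∷ o) (orbitFrom-g n-range n (σ-range n-range) (orbitFrom-∌ π n n (σ n))) ⟩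
    suc n ∷ n ∷ orbitFrom π n n (σ n)
      ≡⟨ cong (suc n ∷_) (cycleOf-≡ n) ⟨
    suc n ∷ cycleOf π n
      ∎
    where open ≡-Reasoning

  cycleOf-g-low : InRange n m → n ∉ cycleOf π m → cycleOf g m ≡ cycleOf π m
  cycleOf-g-low {m} m-range n∉ = begin
    cycleOf g m
      ≡⟨ Perm.cycleOf-≡ g-perm m ⟩
    m ∷ orbitFrom g m (suc n) (app g m)
      ≡⟨ cong (λ y → m ∷ orbitFrom g m (suc n) y) (app-g m-range) ⟩
    m ∷ orbitFrom g m (suc n) (punchIn n (σ m))
      ≡⟨ cong (λ l → m ∷ orbitFrom g l (suc n) (punchIn n (σ m))) m-fixed ⟨
    m ∷ orbitFrom g (punchIn n m) (suc n) (punchIn n (σ m))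
      ≡⟨ cong (m ∷_) (orbitFrom-g m-range (suc n) (σ-range m-range) n∉orbit) ⟩
    m ∷ orbitFrom π m (suc n) (σ m)
      ≡⟨ cong (m ∷_) orbit-fuel ⟩
    m ∷ orbitFrom π m n (σ m)
      ≡⟨ cycleOf-≡ m ⟨
    cycleOf π m
      ∎
    where
    open ≡-Reasoning
    m-fixed : punchIn n m ≡ m
    m-fixed = punchIn-< (≤∧≢⇒< (proj₂ m-range) λ { refl → n∉ (here refl) })
    orbit-fuel : orbitFrom π m (suc n) (σ m) ≡ orbitFrom π m n (σ m)
    orbit-fuel = orbitFrom-fuel m-range (n≤1+n n)
    n∉orbit : n ∉ orbitFrom π m (suc n) (σ m)
    n∉orbit = n∉ ∘ subst (n ∈_) (sym (cycleOf-≡ m)) ∘ there ∘ subst (n ∈_) orbit-fuel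

  1+n∈cycleOf-g : InRange n m → n ∈ cycleOf π m → suc n ∈ cycleOf g m
  1+n∈cycleOf-g {m} m-range n∈ = Perm.∈-cycleOf-sym g-perm (s≤s z≤n , ≤-refl)
    (subst (m ∈_) (sym cycleOf-g-top) (there (∈-cycleOf-sym m-range n∈)))

  block-g-low : InRange k m → block g m ≡ block π m
  block-g-low {m} (0<m , m≤k) with n ∈? cycleOf π m
  ... | yes n∈ = trans (block-nonmax g (1+n∈cycleOf-g m-range n∈) (s≤s (m≤n⇒m≤1+n m≤k)))
                       (sym (block-nonmax π n∈ (s≤s m≤k)))
    where
    m-range : InRange n m
    m-range = 0<m , m≤n⇒m≤1+n m≤k
  ... | no  n∉ = block-cong g π (cycleOf-g-low (0<m , m≤n⇒m≤1+n m≤k) n∉)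

  block-g-next : block g n ≡ []
  block-g-next = block-nonmax g (1+n∈cycleOf-g n-range (here refl)) ≤-refl

  cycleOf-π-top≤ : All (_≤ n) (cycleOf π n)
  cycleOf-π-top≤ = All.map proj₂ (cycleOf-range n-range)

  θ-π : θ π ≡ blocksUpTo π k ++ cycleOf π n
  θ-π = begin
    blocksUpTo π (length π)        ≡⟨ cong (blocksUpTo π) length≡ ⟩
    blocksUpTo π n                 ≡⟨ blocksUpTo-suc π k ⟩
    blocksUpTo π k ++ block π n    ≡⟨ cong (blocksUpTo π k ++_) (block-max π n cycleOf-π-top≤) ⟩
    blocksUpTo π k ++ cycleOf π n  ∎
    where open ≡-Reasoning

  θ-g : θ g ≡ blocksUpTo π k ++ suc n ∷ cycleOf π n
  θ-g = begin
    blocksUpTo g (length g)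
      ≡⟨ cong (blocksUpTo g) (IsPerm.length≡ g-perm) ⟩
    blocksUpTo g (suc n)
      ≡⟨ blocksUpTo-suc g n ⟩
    blocksUpTo g n ++ block g (suc n)
      ≡⟨ cong (_++ block g (suc n)) (blocksUpTo-suc g k) ⟩
    (blocksUpTo g k ++ block g n) ++ block g (suc n)
      ≡⟨ ++-assoc (blocksUpTo g k) (block g n) (block g (suc n)) ⟩
    blocksUpTo g k ++ block g n ++ block g (suc n)
      ≡⟨ cong₂ (λ as bs → as ++ bs ++ block g (suc n)) (blocksUpTo-cong g π k block-g-low) block-g-next ⟩
    blocksUpTo π k ++ block g (suc n)
      ≡⟨ cong (blocksUpTo π k ++_) (trans (block-max g (suc n) top≤) cycleOf-g-top) ⟩
    blocksUpTo π k ++ suc n ∷ cycleOf π n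
      ∎
    where
    open ≡-Reasoning
    top≤ : All (_≤ suc n) (cycleOf g (suc n))
    top≤ = All.map proj₂ (Perm.cycleOf-range g-perm (s≤s z≤n , ≤-refl))

  avoids-g : Avoids231 π → Avoids231 g
  avoids-g = avoids231-transfer {π} {g} (has231-map⁻ π punchIn-reflects ∘ has231-++-[]⁻ _ g≤)
    where
    g≤ : All (_≤ suc n) (map (punchIn n) π)
    g≤ = All.map proj₂ (All-++⁻ˡ (map (punchIn n) π) (IsPerm.inRange g-perm))

  avoids-θg : Avoids231 (θ π) → Avoids231 (θ g)
  avoids-θg = avoids231-transfer {θ π} {θ g} (subst Has231 (sym θ-π)
    ∘ has231-insert⁻ (blocksUpTo π k) (All.map s≤s (blocksUpTo-≤ π k)) (All.tail cycleOf-π-top≤) ≤-refl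
    ∘ subst Has231 θ-g)

  avoids-g⁻ : Avoids231 g → Avoids231 π
  avoids-g⁻ = avoids231-transfer {g} {π} (has231-⊆ (++⁺ʳ _ ⊆-refl) ∘ has231-map⁺ punchIn-mono)

  avoids-θg⁻ : Avoids231 (θ g) → Avoids231 (θ π)
  avoids-θg⁻ = avoids231-transfer {θ g} {θ π}
    (subst Has231 (sym θ-g) ∘ has231-⊆ (++⁺ ⊆-refl (suc n ∷ʳ ⊆-refl)) ∘ subst Has231 θ-π)

-- The last entry of a good permutation

module LastEntry {k π} (isPerm : IsPerm (suc (suc k)) π) where
  open IsPerm isPerm
  open Perm isPerm

  n N : ℕ
  n = suc k
  N = suc n

  n-range : InRange N n
  n-range = s≤s z≤n , n≤1+n n

  N-range : InRange N N
  N-range = s≤s z≤n , ≤-refl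

  θ-split : θ π ≡ blocksUpTo π k ++ block π n ++ cycleOf π N
  θ-split = begin
    blocksUpTo π (length π)                     ≡⟨ cong (blocksUpTo π) length≡ ⟩
    blocksUpTo π N                              ≡⟨ blocksUpTo-suc π n ⟩
    blocksUpTo π n ++ block π N                 ≡⟨ cong (_++ block π N) (blocksUpTo-suc π k) ⟩
    (blocksUpTo π k ++ block π n) ++ block π N  ≡⟨ ++-assoc (blocksUpTo π k) (block π n) (block π N) ⟩
    blocksUpTo π k ++ block π n ++ block π N    ≡⟨ cong (λ c → blocksUpTo π k ++ block π n ++ c) top-block ⟩
    blocksUpTo π k ++ block π n ++ cycleOf π N  ∎
    where
    open ≡-Reasoning
    top-block : block π N ≡ cycleOf π N
    top-block = block-max π N (All.map proj₂ (cycleOf-range N-range))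

  cycleOf-top-⊆ : cycleOf π N ⊆ θ π
  cycleOf-top-⊆ =
    subst (cycleOf π N ⊆_) (sym θ-split) (++⁺ˡ (blocksUpTo π k) (++⁺ˡ (block π n) ⊆-refl))

  next-max-⊆ : All (_≤ n) (cycleOf π n) → σ N ≢ N → n ∷ N ∷ σ N ∷ [] ⊆ θ π
  next-max-⊆ cycle≤n σN≢N = subst (n ∷ N ∷ σ N ∷ [] ⊆_) (sym θ-split) (++⁺ˡ (blocksUpTo π k)
    (subst (λ c → n ∷ N ∷ σ N ∷ [] ⊆ c ++ cycleOf π N) (sym (block-max π n cycle≤n))
      (refl ∷ ++⁺ˡ (orbitFrom π n (length π) (σ n)) top-⊆)))
    where
    top-⊆ : N ∷ σ N ∷ [] ⊆ cycleOf π N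
    top-⊆ = subst (N ∷ σ N ∷ [] ⊆_) (sym (trans (cycleOf-≡ N) (cong (N ∷_) (orbitFrom-step π n σN≢N))))
                  (refl ∷ refl ∷ minimum _)

  top-cycle-⊆ : ∀ {q j} → N ∈ cycleOf π n → InRange N q → σ q ≡ n → InRange N j → σ j ≡ N →
    j ≢ n → q ∷ n ∷ j ∷ [] ⊆ cycleOf π N
  top-cycle-⊆ {q} {j} N∈ q-range σq≡n j-range σj≡N j≢n with cycleOf≡applyUpTo N-range
  ... | r , periodic , cycle≡
    with ∈-applyUpTo⁻ (iterate σ N) (subst (n ∈_) cycle≡ (∈-cycleOf-sym n-range N∈))
  ...   | zero  , _   , n≡N = ⊥-elim (<⇒≢ ≤-refl n≡N)
  ...   | suc t , t<r , n≡  =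
    subst (_⊆ cycleOf π N) (sym positions≡) (subst (f t ∷ f (suc t) ∷ f r ∷ [] ⊆_) (sym cycle≡)
      (subst (f t ∷ f (suc t) ∷ f r ∷ [] ⊆_) (applyUpTo-∷ʳ f r)
        (++⁺ (applyUpTo-⊆ f ≤-refl 1+t<r) (refl ∷ []))))
    where
    open ≡-Reasoning
    f : ℕ → ℕ
    f = iterate σ N
    q≡ : q ≡ f t
    q≡ = σ-injective q-range (iterate-range N-range t) (begin
      σ q      ≡⟨ σq≡n ⟩
      n        ≡⟨ n≡ ⟩
      f (suc t) ≡⟨ iterate-suc σ N t ⟩
      σ (f t)  ∎)
    j≡ : j ≡ f r
    j≡ = σ-injective j-range (iterate-range N-range r) (begin
      σ j       ≡⟨ σj≡N ⟩
      N         ≡⟨ periodic ⟨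
      f (suc r) ≡⟨ iterate-suc σ N r ⟩
      σ (f r)   ∎)
    1+t<r : suc t < r
    1+t<r = ≤∧≢⇒< (≤-pred t<r) λ { refl → j≢n (trans j≡ (sym n≡)) }
    positions≡ : q ∷ n ∷ j ∷ [] ≡ f t ∷ f (suc t) ∷ f r ∷ []
    positions≡ = cong₂ _∷_ q≡ (cong₂ _∷_ n≡ (cong [_] j≡))

  has231-next-before-top : ∀ {q j} → InRange N q → σ q ≡ n → σ j ≡ N → j ≤ n → q < j →
    σ N < n → Has231 π
  has231-next-before-top {suc q} {suc j} _ σq≡n σj≡N j<n (s≤s q<j) σN<n = occurrence
    (subst₂ (λ a b → a ∷ b ∷ σ N ∷ [] ⊆ π) σq≡n σj≡N
            (app-⊆₃ π q<j j<n (subst (n <_) (sym length≡) ≤-refl)))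
    σN<n ≤-refl

  lastEntry : Avoids231 π → Avoids231 (θ π) → σ N ≡ N ⊎ σ N ≡ n
  lastEntry avoids avoidsθ with σ N ≟ N | σ N ≟ n
  ... | yes σN≡N | _        = inj₁ σN≡N
  ... | no  _    | yes σN≡n = inj₂ σN≡n
  ... | no  σN≢N | no  σN≢n with σ-surjective n-range | σ-surjective N-range
  ...   | q , q-range , σq≡n | j , j-range , σj≡N = ⊥-elim (avoidsθ (has231⇒contains231 θ-has231))
    where
    σN<n : σ N < n
    σN<n = ≤∧≢⇒< (≤-pred (≤∧≢⇒< (proj₂ (σ-range N-range)) σN≢N)) σN≢n

    q≤n : q ≤ n
    q≤n = ≤-pred (≤∧≢⇒< (proj₂ q-range) λ { refl → σN≢n σq≡n })

    j≤n : j ≤ n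
    j≤n = ≤-pred (≤∧≢⇒< (proj₂ j-range) λ { refl → σN≢N σj≡N })

    j<q : j < q
    j<q with <-cmp j q
    ... | tri< j<q _ _  = j<q
    ... | tri≈ _ refl _ = ⊥-elim (<⇒≢ ≤-refl (trans (sym σq≡n) σj≡N))
    ... | tri> _ _ q<j  = ⊥-elim (avoids (has231⇒contains231
                            (has231-next-before-top q-range σq≡n σj≡N j≤n q<j σN<n)))

    θ-has231 : Has231 (θ π)
    θ-has231 with All.all? (_≤? n) (cycleOf π n)
    ... | yes cycle≤n = occurrence (next-max-⊆ cycle≤n σN≢N) σN<n ≤-refl
    ... | no  cycle≰n with find (¬All⇒Any¬ (_≤? n) (cycleOf π n) cycle≰n)
    ...   | z , z∈ , z≰n = occurrence
      (⊆-trans (top-cycle-⊆ N∈ q-range σq≡n j-range σj≡N (<⇒≢ (<-≤-trans j<q q≤n))) cycleOf-top-⊆)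
      j<q q<n
      where
      N∈ : N ∈ cycleOf π n
      N∈ = subst (_∈ cycleOf π n) (≤-antisym (proj₂ (All.lookup (cycleOf-range n-range) z∈)) (≰⇒> z≰n)) z∈
      fixed-cycle : q ≡ n → cycleOf π n ≡ [ n ]
      fixed-cycle refl =
        trans (cycleOf-≡ q) (cong (q ∷_) (trans (cong (orbitFrom π q N) σq≡n) (orbitFrom-stop π q N)))
      q<n : q < n
      q<n = ≤∧≢⇒< q≤n λ q≡n → cycle≰n (subst (All (_≤ n)) (sym (fixed-cycle q≡n)) (≤-refl ∷ []))

BothAvoid231 : ℕ → List ℕ → Set
BothAvoid231 n π = IsPerm n π × Avoids231 π × Avoids231 (θ π)

bothAvoiding : ℕ → List (List ℕ)
bothAvoiding n = filter both231? (Sym n)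

∈-bothAvoiding⁻ : ∀ {n π} → π ∈ bothAvoiding n → BothAvoid231 n π
∈-bothAvoiding⁻ {n} π∈ with ∈-filter⁻ both231? {xs = Sym n} π∈
... | π∈Sym , both = ∈-Sym⁻ π∈Sym , both

∈-bothAvoiding⁺ : ∀ {n π} → BothAvoid231 n π → π ∈ bothAvoiding n
∈-bothAvoiding⁺ (isPerm , both) = ∈-filter⁺ both231? (∈-Sym⁺ isPerm) both

bothAvoiding-unique : ∀ n → Unique (bothAvoiding n)
bothAvoiding-unique n = Unique.filter⁺ both231? (Sym-unique n)

unique-++-[]⁻ : ∀ (xs : List A) {x} → Unique (xs ++ [ x ]) → Unique xs × All (_≢ x) xs
unique-++-[]⁻ []       _             = [] , []
unique-++-[]⁻ (y ∷ xs) (y∉xs ∷ uniq) = let uniq′ , ≢x = unique-++-[]⁻ xs uniq in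
  All-++⁻ˡ xs y∉xs ∷ uniq′ , All.head (All-++⁻ʳ xs y∉xs) ∷ ≢x

IsPerm-++-[]⁻ : ∀ {n π x} → IsPerm (suc n) (π ++ [ x ]) →
  length π ≡ n × All (λ y → InRange (suc n) y × y ≢ x) π × Unique π
IsPerm-++-[]⁻ {π = π} (perm length≡ inRange unique) = let uniq , ≢x = unique-++-[]⁻ π unique in
  suc-injective (trans (sym (length-++-[] π)) length≡) , All.zip (All-++⁻ˡ π inRange , ≢x) , uniq

IsPerm-++-top⁻ : ∀ {n π} → IsPerm (suc n) (π ++ [ suc n ]) → IsPerm n π
IsPerm-++-top⁻ isPerm = let length≡ , inRange , uniq = IsPerm-++-[]⁻ isPerm in
  perm length≡ (All.map (λ ((0<y , y≤1+n) , y≢1+n) → 0<y , ≤-pred (≤∧≢⇒< y≤1+n y≢1+n)) inRange) uniq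

IsPerm-++-next⁻ : ∀ {n π} → 0 < n → IsPerm (suc n) (π ++ [ n ]) →
  IsPerm n (map (punchOut n) π) × map (punchIn n) (map (punchOut n) π) ≡ π
IsPerm-++-next⁻ {n} {π} 0<n isPerm with IsPerm-++-[]⁻ isPerm
... | length≡ , inRange , uniq =
  perm (trans (length-map (punchOut n) π) length≡)
       (All-map⁺ (All.map (λ (y-range , y≢n) → punchOut-range 0<n y-range y≢n) inRange))
       (Unique.map⁻ (subst Unique (sym punchIn∘punchOut) uniq))
  , punchIn∘punchOut
  where
  punchIn∘punchOut : map (punchIn n) (map (punchOut n) π) ≡ π
  punchIn∘punchOut = trans (sym (map-∘ π)) (map-id-local (All.map (punchIn-punchOut ∘ proj₂) inRange))

lastEntry-++ : ∀ {k π b} → IsPerm (suc (suc k)) (π ++ [ b ]) →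
  Avoids231 (π ++ [ b ]) → Avoids231 (θ (π ++ [ b ])) → b ≡ suc (suc k) ⊎ b ≡ suc k
lastEntry-++ {k} {π} {b} isPerm avoids avoidsθ =
  Sum.map (trans (sym σN≡b)) (trans (sym σN≡b)) (LastEntry.lastEntry isPerm avoids avoidsθ)
  where
  σN≡b : app (π ++ [ b ]) (suc (suc k)) ≡ b
  σN≡b = subst (λ l → app (π ++ [ b ]) (suc l) ≡ b) (proj₁ (IsPerm-++-[]⁻ isPerm)) (app-++-[] π)

extensions : ℕ → List (List ℕ)
extensions n = map (extendTop n) (bothAvoiding n) ++ map (extendNext n) (bothAvoiding n)

extensions⊆bothAvoiding : ∀ k → extensions (suc k) ⊆ₛ bothAvoiding (suc (suc k))
extensions⊆bothAvoiding k z∈ with ∈-++⁻ (map (extendTop (suc k)) (bothAvoiding (suc k))) z∈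
... | inj₁ z∈top with ∈-map⁻ (extendTop (suc k)) z∈top
...   | π , π∈ , refl with ∈-bothAvoiding⁻ π∈
...     | isPerm , avoids , avoidsθ = ∈-bothAvoiding⁺ (ρ-perm , avoids-ρ avoids , avoids-θρ avoidsθ)
  where open ExtendTop isPerm
extensions⊆bothAvoiding k z∈ | inj₂ z∈next with ∈-map⁻ (extendNext (suc k)) z∈next
...   | π , π∈ , refl with ∈-bothAvoiding⁻ π∈
...     | isPerm , avoids , avoidsθ = ∈-bothAvoiding⁺ (g-perm , avoids-g avoids , avoids-θg avoidsθ)
  where open ExtendNext isPerm

bothAvoiding⊆extensions : ∀ k → bothAvoiding (suc (suc k)) ⊆ₛ extensions (suc k)
bothAvoiding⊆extensions k {z} z∈ with ∈-bothAvoiding⁻ z∈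
... | isPerm , avoids , avoidsθ with initLast z
... | [] = ⊥-elim (0≢1+n (IsPerm.length≡ isPerm))
... | π ∷ʳ′ b with lastEntry-++ {k} isPerm avoids avoidsθ
... | inj₁ refl = ∈-++⁺ˡ (∈-map⁺ (extendTop (suc k))
        (∈-bothAvoiding⁺ (IsPerm-++-top⁻ isPerm , avoids-ρ⁻ avoids , avoids-θρ⁻ avoidsθ)))
  where open ExtendTop (IsPerm-++-top⁻ isPerm)
... | inj₂ refl with IsPerm-++-next⁻ (s≤s z≤n) isPerm
...   | isPerm′ , g≡π = ∈-++⁺ʳ _ (subst (_∈ map (extendNext (suc k)) (bothAvoiding (suc k))) g≡π++n
        (∈-map⁺ (extendNext (suc k)) (∈-bothAvoiding⁺ (isPerm′ ,
           avoids-g⁻ (subst Avoids231 (sym g≡π++n) avoids) ,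
           avoids-θg⁻ (subst (Avoids231 ∘ θ) (sym g≡π++n) avoidsθ)))))
  where
  open ExtendNext isPerm′
  g≡π++n : g ≡ π ++ [ suc k ]
  g≡π++n = cong (_++ [ suc k ]) g≡π

extensions-unique : ∀ n → Unique (extensions n)
extensions-unique n = Unique.++⁺
  (Unique.map⁺ (λ {π} {π′} → ∷ʳ-injectiveˡ π π′) (bothAvoiding-unique n))
  (Unique.map⁺ (λ {π} {π′} → map-injective punchIn-injective
                               ∘ ∷ʳ-injectiveˡ (map (punchIn n) π) (map (punchIn n) π′))
               (bothAvoiding-unique n))
  λ (z∈top , z∈next) → case ∈-map⁻ (extendTop n) z∈top , ∈-map⁻ (extendNext n) z∈next of λ where
    ((π , _ , refl) , (π′ , _ , eq)) → 1+n≢n (∷ʳ-injectiveʳ π (map (punchIn n) π′) eq)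

length-extensions : ∀ n → length (extensions n) ≡ length (bothAvoiding n) + length (bothAvoiding n)
length-extensions n = trans (length-++ (map (extendTop n) (bothAvoiding n)))
  (cong₂ _+_ (length-map (extendTop n) (bothAvoiding n)) (length-map (extendNext n) (bothAvoiding n)))

length-bothAvoiding : ∀ k → length (bothAvoiding (suc k)) ≡ 2 ^ k
length-bothAvoiding zero    = refl
length-bothAvoiding (suc k) = begin
  length (bothAvoiding (suc (suc k)))
    ≡⟨ unique⇒length-≡ (bothAvoiding-unique (suc (suc k))) (extensions-unique (suc k))
                       (bothAvoiding⊆extensions k) (extensions⊆bothAvoiding k) ⟩
  length (extensions (suc k))
    ≡⟨ length-extensions (suc k) ⟩
  length (bothAvoiding (suc k)) + length (bothAvoiding (suc k))
    ≡⟨ cong (λ l → l + l) (length-bothAvoiding k) ⟩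
  2 ^ k + 2 ^ k
    ≡⟨ cong (2 ^ k +_) (+-identityʳ (2 ^ k)) ⟨
  2 ^ suc k
    ∎
  where open ≡-Reasoning

theorem3p8 : (n : ℕ) → 1 ≤ n → length (filter both231? (Sym n)) ≡ 2 ^ (n ∸ 1)
theorem3p8 (suc k) _ = length-bothAvoiding k
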